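{- Let $n\ge 5$ and let $\sigma$ be a maximal simplex of $\Delta_n=\mathcal{VR}(\mathbb{I}_n;3)$ that covers all places. If there is $w\in\sigma$ and a vertex $v$ such that $N(w)\cap\sigma=\{v\}$, then $\sigma=N(v)\cup K_v^{i_0,j_0,k_0}$ for some $i_0,j_0,k_0\in[n]$.
   Context: $\mathbb{I}_n$ is the graph on $\{0,1\}^n$, two strings adjacent iff they differ in exactly one coordinate; distance is the number of differing coordinates. $\Delta_n=\mathcal{VR}(\mathbb{I}_n;3)$ is the simplicial complex whose simplices are the sets of vertices with pairwise distance at most $3$. For a vertex $v$, $v(i)$ is its $i$-th coordinate, $v^{i_1,\dots,i_k}$ is $v$ with coordinates $i_1,\dots,i_k$ flipped, and $N(v)=\{v^i:i\in[n]\}$. For distinct $i,j,k\in[n]$, $K_v^{i,j,k}=\{v,v^{i,j},v^{j,k},v^{i,k}\}$. A simplex $\sigma$ covers all places if for each $i\in[n]$ there are $v,w\in\sigma$ with $v(i)=1$ and $w(i)=0$. -}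

module Defs where

open import Data.Bool using (Bool; true; false; not)
open import Data.Nat using (ℕ; zero; suc; _≤_)
open import Data.Fin using (Fin)
open import Data.Vec using (Vec; []; _∷_; lookup; updateAt)
open import Data.Product using (Σ; ∃; ∃-syntax; _×_; _,_)
open import Data.Sum using (_⊎_)
open import Relation.Binary.PropositionalEquality using (_≡_; _≢_)
open import Relation.Nullary using (¬_)

Vertex : ℕ → Set
Vertex n = Vec Bool n

dist : ∀ {n} → Vertex n → Vertex n → ℕ
dist [] [] = zero
dist (true ∷ xs) (true ∷ ys) = dist xs ys
dist (false ∷ xs) (false ∷ ys) = dist xs ys
dist (true ∷ xs) (false ∷ ys) = suc (dist xs ys)
dist (false ∷ xs) (true ∷ ys) = suc (dist xs ys)

flipAt : ∀ {n} → Fin n → Vertex n → Vertex n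
flipAt i v = updateAt v i not

-- A set of vertices, given by its (decidable) characteristic function.
-- Since the vertex set is finite, this is exactly a finite vertex set.
VSet : ℕ → Set
VSet n = Vertex n → Bool

_∈ₛ_ : ∀ {n} → Vertex n → VSet n → Set
x ∈ₛ σ = σ x ≡ true

_⊆ₛ_ : ∀ {n} → VSet n → VSet n → Set
σ ⊆ₛ τ = ∀ x → x ∈ₛ σ → x ∈ₛ τ

IsSimplex : ∀ {n} → VSet n → Set
IsSimplex σ = (∃[ x ] x ∈ₛ σ) × (∀ x y → x ∈ₛ σ → y ∈ₛ σ → dist x y ≤ 3)

IsMaximalSimplex : ∀ {n} → VSet n → Set
IsMaximalSimplex σ = IsSimplex σ × (∀ τ → IsSimplex τ → σ ⊆ₛ τ → τ ⊆ₛ σ)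

CoversAllPlaces : ∀ {n} → VSet n → Set
CoversAllPlaces {n} σ = ∀ (i : Fin n) →
  ∃[ v ] ∃[ w ] (v ∈ₛ σ × w ∈ₛ σ × lookup v i ≡ true × lookup w i ≡ false)

InN : ∀ {n} → Vertex n → Vertex n → Set
InN {n} v x = ∃[ i ] x ≡ flipAt {n} i v

InK : ∀ {n} → Vertex n → Fin n → Fin n → Fin n → Vertex n → Set
InK v i j k x =
  x ≡ v ⊎ x ≡ flipAt i (flipAt j v) ⊎ x ≡ flipAt j (flipAt k v) ⊎ x ≡ flipAt i (flipAt k v)

Distinct3 : ∀ {n} → Fin n → Fin n → Fin n → Set
Distinct3 i j k = i ≢ j × j ≢ k × i ≢ k

-- Write w = v^a.  Every member of σ lies within distance 3 of v; call {p,q} an edge when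
-- v^{p,q} ∈ σ.  Two edges meet, since their vertices are at distance ≤ 3; no edge contains a,
-- since v^{p,a} is a neighbour of w other than v; and for x ≠ a the vertex v^{x,a} is not in σ,
-- so by maximality some member is far from it, and that member is an edge avoiding x.  An
-- intersecting family of 2-sets with no common point is a triangle {c,d,e}.  A member at
-- distance 3 from v would differ from v at a and at two of c, d, e, so it agrees with v at some
-- f ∉ {a,c,d,e} (here n ≥ 5 is used); covering at f then forces a member differing from v at f,
-- which is impossible for each possible shape of that member.  Hence σ ⊆ N(v) ∪ K_v^{c,d,e},
-- and maximality gives equality.

module Submission where

open import Defs
open import Data.Bool using (true; false; not; _∨_)
open import Data.Bool.Properties using (not-involutive; not-¬; ∨-zeroʳ) renaming (_≟_ to _≟ᵇ_)
open import Data.Empty using (⊥; ⊥-elim)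
open import Data.Fin using (Fin; zero; suc)
open import Data.Fin.Properties using (_≟_; ¬∀⟶∃¬; pigeonhole; <-irrefl)
open import Data.List using (List; []; _∷_; length; lookup)
open import Data.List.Membership.Propositional using (_∈_; _∉_)
open import Data.List.Relation.Unary.All using (All; []; _∷_)
open import Data.List.Relation.Unary.AllPairs using ([]; _∷_)
open import Data.List.Relation.Unary.Any using (here; there; index; any?)
open import Data.List.Relation.Unary.Any.Properties using (lookup-index)
open import Data.List.Relation.Unary.Unique.Propositional using (Unique)
open import Data.Nat using (ℕ; zero; suc; _+_; _≤_; _<_; z≤n; s≤s; s≤s⁻¹; _≤?_)
open import Data.Nat.Properties using (≤-trans; ≤-reflexive; n≤1+n; +-suc; +-mono-≤; suc-injective; ≰⇒>; <⇒≱; +-monoˡ-≤; ≤∧≢⇒<; module ≤-Reasoning) renaming (<-irrefl to <-irreflⁿ)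
open import Data.Product using (∃₂; ∃-syntax; _×_; _,_; proj₁; proj₂)
open import Data.Sum using (_⊎_; inj₁; inj₂)
open import Data.Vec using ([]; _∷_) renaming (lookup to lookupᵛ)
open import Data.Vec.Properties using (≡-dec; lookup∘updateAt; lookup∘updateAt′; updateAt-updateAt; updateAt-id-local; updateAt-commutes)
open import Function using (_∘_)
open import Function.Bundles using (_⇔_; mk⇔; Equivalence)
open import Relation.Binary.PropositionalEquality
open import Relation.Binary.Definitions using (DecidableEquality)
open import Level using (_⊔_)
open import Relation.Nullary using (¬_; Dec; yes; no; does; contradiction)
open import Relation.Nullary.Decidable using (_⊎-dec_; _→-dec_)

private variable
  n : ℕ

_≢[_]_ : Vertex n → Fin n → Vertex n → Set
x ≢[ i ] y = lookupᵛ x i ≢ lookupᵛ y i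

dist-self : (x : Vertex n) → dist x x ≡ 0
dist-self [] = refl
dist-self (true ∷ x) = dist-self x
dist-self (false ∷ x) = dist-self x

dist-sym : (x y : Vertex n) → dist x y ≡ dist y x
dist-sym [] [] = refl
dist-sym (true ∷ x) (true ∷ y) = dist-sym x y
dist-sym (true ∷ x) (false ∷ y) = cong suc (dist-sym x y)
dist-sym (false ∷ x) (true ∷ y) = cong suc (dist-sym x y)
dist-sym (false ∷ x) (false ∷ y) = dist-sym x y

dist≡0⇒≡ : (x y : Vertex n) → dist x y ≡ 0 → x ≡ y
dist≡0⇒≡ [] [] _ = refl
dist≡0⇒≡ (true ∷ x) (true ∷ y) eq = cong (true ∷_) (dist≡0⇒≡ x y eq)
dist≡0⇒≡ (false ∷ x) (false ∷ y) eq = cong (false ∷_) (dist≡0⇒≡ x y eq)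

dist-triangle : (x y z : Vertex n) → dist x z ≤ dist x y + dist y z
dist-triangle [] [] [] = z≤n
dist-triangle (true ∷ x) (true ∷ y) (true ∷ z) = dist-triangle x y z
dist-triangle (true ∷ x) (true ∷ y) (false ∷ z) = ≤-trans (s≤s (dist-triangle x y z)) (≤-reflexive (sym (+-suc _ _)))
dist-triangle (true ∷ x) (false ∷ y) (true ∷ z) = ≤-trans (dist-triangle x y z) (+-mono-≤ (n≤1+n _) (n≤1+n _))
dist-triangle (true ∷ x) (false ∷ y) (false ∷ z) = s≤s (dist-triangle x y z)
dist-triangle (false ∷ x) (true ∷ y) (true ∷ z) = s≤s (dist-triangle x y z)
dist-triangle (false ∷ x) (true ∷ y) (false ∷ z) = ≤-trans (dist-triangle x y z) (+-mono-≤ (n≤1+n _) (n≤1+n _))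
dist-triangle (false ∷ x) (false ∷ y) (true ∷ z) = ≤-trans (s≤s (dist-triangle x y z)) (≤-reflexive (sym (+-suc _ _)))
dist-triangle (false ∷ x) (false ∷ y) (false ∷ z) = dist-triangle x y z

dist-via : (x y v : Vertex n) → dist x y ≤ dist x v + dist y v
dist-via x y v = ≤-trans (dist-triangle x v y) (≤-reflexive (cong (dist x v +_) (dist-sym v y)))

dist-flipAt-flipAt : (i : Fin n) (x y : Vertex n) → dist (flipAt i x) (flipAt i y) ≡ dist x y
dist-flipAt-flipAt zero (true ∷ x) (true ∷ y) = refl
dist-flipAt-flipAt zero (true ∷ x) (false ∷ y) = refl
dist-flipAt-flipAt zero (false ∷ x) (true ∷ y) = refl
dist-flipAt-flipAt zero (false ∷ x) (false ∷ y) = refl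
dist-flipAt-flipAt (suc i) (true ∷ x) (true ∷ y) = dist-flipAt-flipAt i x y
dist-flipAt-flipAt (suc i) (true ∷ x) (false ∷ y) = cong suc (dist-flipAt-flipAt i x y)
dist-flipAt-flipAt (suc i) (false ∷ x) (true ∷ y) = cong suc (dist-flipAt-flipAt i x y)
dist-flipAt-flipAt (suc i) (false ∷ x) (false ∷ y) = dist-flipAt-flipAt i x y

dist-flipAt-≢ : (i : Fin n) (x y : Vertex n) → x ≢[ i ] y → dist x y ≡ suc (dist (flipAt i x) y)
dist-flipAt-≢ zero (true ∷ x) (true ∷ y) x≢y = contradiction refl x≢y
dist-flipAt-≢ zero (true ∷ x) (false ∷ y) _ = refl
dist-flipAt-≢ zero (false ∷ x) (true ∷ y) _ = refl
dist-flipAt-≢ zero (false ∷ x) (false ∷ y) x≢y = contradiction refl x≢y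
dist-flipAt-≢ (suc i) (true ∷ x) (true ∷ y) x≢y = dist-flipAt-≢ i x y x≢y
dist-flipAt-≢ (suc i) (true ∷ x) (false ∷ y) x≢y = cong suc (dist-flipAt-≢ i x y x≢y)
dist-flipAt-≢ (suc i) (false ∷ x) (true ∷ y) x≢y = cong suc (dist-flipAt-≢ i x y x≢y)
dist-flipAt-≢ (suc i) (false ∷ x) (false ∷ y) x≢y = dist-flipAt-≢ i x y x≢y

differing-coordinate : (x y : Vertex n) {k : ℕ} → dist x y ≡ suc k → ∃[ i ] x ≢[ i ] y
differing-coordinate [] [] ()
differing-coordinate (true ∷ x) (true ∷ y) eq = let i , d = differing-coordinate x y eq in suc i , d
differing-coordinate (false ∷ x) (false ∷ y) eq = let i , d = differing-coordinate x y eq in suc i , d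
differing-coordinate (true ∷ x) (false ∷ y) _ = zero , λ ()
differing-coordinate (false ∷ x) (true ∷ y) _ = zero , λ ()

dist-disjoint : (x y v : Vertex n) →
  (∀ t → lookupᵛ x t ≡ lookupᵛ v t ⊎ lookupᵛ y t ≡ lookupᵛ v t) →
  dist x v + dist y v ≡ dist x y
dist-disjoint [] [] [] _ = refl
dist-disjoint (x₀ ∷ x) (y₀ ∷ y) (v₀ ∷ v) agree with agree zero | dist-disjoint x y v (agree ∘ suc)
dist-disjoint (true ∷ x) (true ∷ y) (true ∷ v) _ | _ | eq = eq
dist-disjoint (true ∷ x) (false ∷ y) (true ∷ v) _ | _ | eq = trans (+-suc _ _) (cong suc eq)
dist-disjoint (false ∷ x) (true ∷ y) (true ∷ v) _ | _ | eq = cong suc eq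
dist-disjoint (true ∷ x) (false ∷ y) (false ∷ v) _ | _ | eq = cong suc eq
dist-disjoint (false ∷ x) (true ∷ y) (false ∷ v) _ | _ | eq = trans (+-suc _ _) (cong suc eq)
dist-disjoint (false ∷ x) (false ∷ y) (false ∷ v) _ | _ | eq = eq
dist-disjoint (true ∷ x) (true ∷ y) (false ∷ v) _ | inj₁ () | _
dist-disjoint (true ∷ x) (true ∷ y) (false ∷ v) _ | inj₂ () | _
dist-disjoint (false ∷ x) (false ∷ y) (true ∷ v) _ | inj₁ () | _
dist-disjoint (false ∷ x) (false ∷ y) (true ∷ v) _ | inj₂ () | _

common-differing : (x y v : Vertex n) → dist x y < dist x v + dist y v →
  ∃[ t ] (x ≢[ t ] v × y ≢[ t ] v)
common-differing {n} x y v shorter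
  with ¬∀⟶∃¬ n _ (λ t → (lookupᵛ x t ≟ᵇ lookupᵛ v t) ⊎-dec (lookupᵛ y t ≟ᵇ lookupᵛ v t))
         (λ agree → <-irreflⁿ (sym (dist-disjoint x y v agree)) shorter)
... | t , neither = t , neither ∘ inj₁ , neither ∘ inj₂

dist-common : (x y v : Vertex n) {t : Fin n} → x ≢[ t ] v → y ≢[ t ] v →
  2 + dist x y ≤ dist x v + dist y v
dist-common x y v {t} x≢v y≢v = begin
  2 + dist x y                                          ≡⟨ cong (2 +_) (sym (dist-flipAt-flipAt t x y)) ⟩
  2 + dist (flipAt t x) (flipAt t y)                    ≤⟨ s≤s (s≤s (dist-via (flipAt t x) (flipAt t y) v)) ⟩
  suc (suc (dist (flipAt t x) v + dist (flipAt t y) v)) ≡⟨ cong suc (sym (+-suc _ _)) ⟩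
  suc (dist (flipAt t x) v) + suc (dist (flipAt t y) v) ≡⟨ sym (cong₂ _+_ (dist-flipAt-≢ t x v x≢v) (dist-flipAt-≢ t y v y≢v)) ⟩
  dist x v + dist y v                                   ∎
  where open ≤-Reasoning

length≤dist : (I : List (Fin n)) (x y : Vertex n) → Unique I → All (x ≢[_] y) I → length I ≤ dist x y
length≤dist [] x y _ _ = z≤n
length≤dist (i ∷ I) x y (i∉I ∷ uI) (dᵢ ∷ ds) rewrite dist-flipAt-≢ i x y dᵢ =
  s≤s (length≤dist I (flipAt i x) y uI (still-differ i∉I ds))
  where
  still-differ : ∀ {J} → All (i ≢_) J → All (x ≢[_] y) J → All (flipAt i x ≢[_] y) J
  still-differ [] [] = []
  still-differ {j ∷ _} (i≢j ∷ i≢J) (dⱼ ∷ ds) =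
    (λ eq → dⱼ (trans (sym (lookup∘updateAt′ j i (i≢j ∘ sym) x)) eq)) ∷ still-differ i≢J ds

flipAt-involutive : (i : Fin n) (x : Vertex n) → flipAt i (flipAt i x) ≡ x
flipAt-involutive i x = trans (updateAt-updateAt i x) (updateAt-id-local i x (not-involutive _))

flipAt-≢[] : (i : Fin n) (x : Vertex n) → flipAt i x ≢[ i ] x
flipAt-≢[] i x eq = not-¬ refl (trans (sym eq) (lookup∘updateAt i x))

≢[]-flipAt : (i : Fin n) (x : Vertex n) {t : Fin n} → flipAt i x ≢[ t ] x → t ≡ i
≢[]-flipAt i x {t} d with t ≟ i
... | yes t≡i = t≡i
... | no t≢i = contradiction (lookup∘updateAt′ t i t≢i x) d

flipAt²-≢[] : (x : Vertex n) {p q t : Fin n} → p ≢ q → t ∈ p ∷ q ∷ [] → flipAt p (flipAt q x) ≢[ t ] x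
flipAt²-≢[] x {p} {q} p≢q (here refl) eq =
  not-¬ refl (trans (sym eq) (trans (lookup∘updateAt p (flipAt q x)) (cong not (lookup∘updateAt′ p q p≢q x))))
flipAt²-≢[] x {p} {q} p≢q (there (here refl)) eq =
  flipAt-≢[] q x (trans (sym (lookup∘updateAt′ q p (p≢q ∘ sym) (flipAt q x))) eq)

≢[]-flipAt² : (p q : Fin n) (x : Vertex n) {t : Fin n} → flipAt p (flipAt q x) ≢[ t ] x → t ∈ p ∷ q ∷ []
≢[]-flipAt² p q x {t} d with t ≟ p | t ≟ q
... | yes t≡p | _ = here t≡p
... | no _ | yes t≡q = there (here t≡q)
... | no t≢p | no t≢q =
  contradiction (trans (lookup∘updateAt′ t p t≢p (flipAt q x)) (lookup∘updateAt′ t q t≢q x)) d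

dist-flipAt : (i : Fin n) (x : Vertex n) → dist (flipAt i x) x ≡ 1
dist-flipAt i x = begin
  dist (flipAt i x) x                  ≡⟨ dist-flipAt-≢ i (flipAt i x) x (flipAt-≢[] i x) ⟩
  suc (dist (flipAt i (flipAt i x)) x) ≡⟨ cong (λ y → suc (dist y x)) (flipAt-involutive i x) ⟩
  suc (dist x x)                       ≡⟨ cong suc (dist-self x) ⟩
  1                                    ∎
  where open ≡-Reasoning

dist-flipAt² : {p q : Fin n} (x : Vertex n) → p ≢ q → dist (flipAt p (flipAt q x)) x ≡ 2
dist-flipAt² {p = p} {q} x p≢q = begin
  dist (flipAt p (flipAt q x)) x                  ≡⟨ dist-flipAt-≢ p (flipAt p (flipAt q x)) x (flipAt²-≢[] x p≢q (here refl)) ⟩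
  suc (dist (flipAt p (flipAt p (flipAt q x))) x) ≡⟨ cong (λ y → suc (dist y x)) (flipAt-involutive p (flipAt q x)) ⟩
  suc (dist (flipAt q x) x)                       ≡⟨ cong suc (dist-flipAt q x) ⟩
  2                                               ∎
  where open ≡-Reasoning

flipAt-inverse : (i : Fin n) {x y : Vertex n} → flipAt i y ≡ x → y ≡ flipAt i x
flipAt-inverse i {y = y} eq = trans (sym (flipAt-involutive i y)) (cong (flipAt i) eq)

dist-suc⇒closer : (y x : Vertex n) {k : ℕ} → dist y x ≡ suc k →
  ∃[ i ] (y ≢[ i ] x × dist (flipAt i y) x ≡ k)
dist-suc⇒closer y x eq with differing-coordinate y x eq
... | i , d = i , d , suc-injective (trans (sym (dist-flipAt-≢ i y x d)) eq)

dist≡1⇒flipAt : (y x : Vertex n) → dist y x ≡ 1 → ∃[ i ] y ≡ flipAt i x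
dist≡1⇒flipAt y x eq with dist-suc⇒closer y x eq
... | i , _ , dist≡0 = i , flipAt-inverse i (dist≡0⇒≡ (flipAt i y) x dist≡0)

dist≡2⇒flipAt² : (y x : Vertex n) → dist y x ≡ 2 → ∃₂ λ p q → p ≢ q × y ≡ flipAt p (flipAt q x)
dist≡2⇒flipAt² y x eq with dist-suc⇒closer y x eq
... | p , y≢ᵖx , dist≡1 with dist≡1⇒flipAt (flipAt p y) x dist≡1
... | q , eq′ = p , q , p≢q , y≡
  where
  y≡ : y ≡ flipAt p (flipAt q x)
  y≡ = flipAt-inverse p eq′
  p≢q : p ≢ q
  p≢q refl = y≢ᵖx (cong (λ z → lookupᵛ z p) (trans y≡ (flipAt-involutive p x)))

other-corner : (y v : Vertex n) {p q : Fin n} → lookupᵛ y p ≡ lookupᵛ v p →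
  ∃[ t ] (t ∈ p ∷ q ∷ [] × y ≢[ t ] v) → y ≢[ q ] v
other-corner _ _ agree (_ , here refl , y≢v) = contradiction agree y≢v
other-corner _ _ agree (_ , there (here refl) , y≢v) = y≢v

data Within3 (x : Vertex n) : Vertex n → Set where
  centre : Within3 x x
  one    : (i : Fin n) → Within3 x (flipAt i x)
  two    : {p q : Fin n} → p ≢ q → Within3 x (flipAt p (flipAt q x))
  three  : {y : Vertex n} → dist y x ≡ 3 → Within3 x y

within3 : (y x : Vertex n) → dist y x ≤ 3 → Within3 x y
within3 y x y≤3 with dist y x in eq
... | 0 rewrite dist≡0⇒≡ y x eq = centre
... | 1 with dist≡1⇒flipAt y x eq
...   | i , refl = one i
within3 y x y≤3 | 2 with dist≡2⇒flipAt² y x eq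
...   | _ , _ , p≢q , refl = two p≢q
within3 y x y≤3 | 3 = three eq
within3 y x (s≤s (s≤s (s≤s ()))) | suc (suc (suc (suc _)))

∉-pair : ∀ {ℓ} {A : Set ℓ} {x p q : A} → x ≢ p → x ≢ q → x ∉ p ∷ q ∷ []
∉-pair x≢p _ (here x≡p) = x≢p x≡p
∉-pair _ x≢q (there (here x≡q)) = x≢q x≡q

∉⇒≢ : ∀ {ℓ} {A : Set ℓ} {x t : A} {xs : List A} → x ∉ xs → t ∈ xs → x ≢ t
∉⇒≢ x∉ t∈ refl = x∉ t∈

∃-∉ : (xs : List (Fin n)) → length xs < n → ∃[ f ] f ∉ xs
∃-∉ {n} xs shorter = ¬∀⟶∃¬ n (_∈ xs) (λ i → any? (i ≟_) xs) all-in-impossible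
  where
  all-in-impossible : ¬ (∀ i → i ∈ xs)
  all-in-impossible all-in with pigeonhole shorter (index ∘ all-in)
  ... | i , j , i<j , same-index =
    <-irrefl (trans (lookup-index (all-in i)) (trans (cong (lookup xs) same-index) (sym (lookup-index (all-in j))))) i<j

∀-or-counterexample : (P : Vertex n → Set) → (∀ x → Dec (P x)) → (∀ x → P x) ⊎ ∃[ x ] ¬ P x
∀-or-counterexample {zero} P P? with P? []
... | yes p = inj₁ λ { [] → p }
... | no ¬p = inj₂ ([] , ¬p)
∀-or-counterexample {suc n} P P?
  with ∀-or-counterexample (P ∘ (true ∷_)) (P? ∘ (true ∷_))
     | ∀-or-counterexample (P ∘ (false ∷_)) (P? ∘ (false ∷_))
... | inj₂ (x , ¬p) | _ = inj₂ (true ∷ x , ¬p)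
... | inj₁ _ | inj₂ (x , ¬p) = inj₂ (false ∷ x , ¬p)
... | inj₁ pᵗ | inj₁ pᶠ = inj₁ λ { (true ∷ x) → pᵗ x ; (false ∷ x) → pᶠ x }

insert : Vertex n → VSet n → VSet n
insert u σ x = σ x ∨ does (≡-dec _≟ᵇ_ x u)

maximal-∋ : {σ : VSet n} → IsMaximalSimplex σ → (u : Vertex n) →
  (∀ y → y ∈ₛ σ → dist y u ≤ 3) → u ∈ₛ σ
maximal-∋ {σ = σ} ((nonempty , close) , maximal) u u-close =
  maximal (insert u σ) ((proj₁ nonempty , ⊆-insert _ (proj₂ nonempty)) , close′) ⊆-insert u u∈
  where
  ⊆-insert : σ ⊆ₛ insert u σ
  ⊆-insert x x∈ rewrite x∈ = refl
  u∈ : u ∈ₛ insert u σ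
  u∈ with ≡-dec _≟ᵇ_ u u
  ... | yes _ = ∨-zeroʳ (σ u)
  ... | no u≢u = contradiction refl u≢u
  insert⁻ : ∀ x → x ∈ₛ insert u σ → x ∈ₛ σ ⊎ x ≡ u
  insert⁻ x x∈ with σ x | ≡-dec _≟ᵇ_ x u
  ... | true | _ = inj₁ refl
  ... | false | yes x≡u = inj₂ x≡u
  insert⁻ x () | false | no _
  close′ : ∀ x y → x ∈ₛ insert u σ → y ∈ₛ insert u σ → dist x y ≤ 3
  close′ x y x∈ y∈ with insert⁻ x x∈ | insert⁻ y y∈
  ... | inj₁ x∈σ | inj₁ y∈σ = close x y x∈σ y∈σ
  ... | inj₁ x∈σ | inj₂ refl = u-close x x∈σ
  ... | inj₂ refl | inj₁ y∈σ = ≤-trans (≤-reflexive (dist-sym u y)) (u-close y y∈σ)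
  ... | inj₂ refl | inj₂ refl = ≤-trans (≤-reflexive (dist-self u)) z≤n

maximal-∌⇒far : {σ : VSet n} → IsMaximalSimplex σ → (u : Vertex n) → ¬ u ∈ₛ σ →
  ∃[ y ] (y ∈ₛ σ × 3 < dist y u)
maximal-∌⇒far {σ = σ} maximal u u∉
  with ∀-or-counterexample (λ y → y ∈ₛ σ → dist y u ≤ 3) (λ y → (σ y ≟ᵇ true) →-dec (dist y u ≤? 3))
... | inj₁ u-close = contradiction (maximal-∋ maximal u u-close) u∉
... | inj₂ (y , ¬close) with σ y ≟ᵇ true
...   | yes y∈ = y , y∈ , ≰⇒> (¬close ∘ λ y≤3 _ → y≤3)
...   | no y∉ = contradiction (λ y∈ → contradiction y∈ y∉) ¬close

differing-member : {σ : VSet n} → CoversAllPlaces σ → (f : Fin n) (x : Vertex n) →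
  ∃[ z ] (z ∈ₛ σ × z ≢[ f ] x)
differing-member covers f x with covers f
... | z₁ , z₂ , z₁∈ , z₂∈ , z₁f , z₂f with lookupᵛ z₁ f ≟ᵇ lookupᵛ x f
...   | no z₁≢x = z₁ , z₁∈ , z₁≢x
...   | yes z₁≡x = z₂ , z₂∈ , λ z₂≡x → contradiction (trans (sym z₁f) (trans z₁≡x (trans (sym z₂≡x) z₂f))) λ ()

module IntersectingEdges {a ℓ} {A : Set a} (_≟ᴬ_ : DecidableEquality A) (E : A → A → Set ℓ)
  (E-sym : ∀ {p q} → E p q → E q p)
  (E-irrefl : ∀ {p q} → E p q → p ≢ q)
  (E-meet : ∀ {p q r s} → E p q → E r s → ∃[ t ] (t ∈ p ∷ q ∷ [] × t ∈ r ∷ s ∷ []))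
  where

  record Triangle : Set (a ⊔ ℓ) where
    field
      c d e : A
      cd : E c d
      de : E d e
      ce : E c e
      spans : ∀ {g h} → E g h → g ∈ c ∷ d ∷ e ∷ []

  private
    meets-other-end : ∀ {p q r s} → E p q → E r s → p ∉ r ∷ s ∷ [] → q ∈ r ∷ s ∷ []
    meets-other-end epq ers p∉ with E-meet epq ers
    ... | _ , here refl , t∈ = contradiction t∈ p∉
    ... | _ , there (here refl) , t∈ = t∈

    other-end : ∀ {x p q} → x ∈ p ∷ q ∷ [] → E p q → ∃[ y ] (y ∈ p ∷ q ∷ [] × E x y)
    other-end (here refl) epq = _ , there (here refl) , epq
    other-end (there (here refl)) epq = _ , here refl , E-sym epq

    edge-between : ∀ {p q x y} → E p q → x ∈ p ∷ q ∷ [] → y ∈ p ∷ q ∷ [] → x ≢ y → E x y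
    edge-between epq (here refl) (here refl) x≢y = contradiction refl x≢y
    edge-between epq (here refl) (there (here refl)) _ = epq
    edge-between epq (there (here refl)) (here refl) _ = E-sym epq
    edge-between epq (there (here refl)) (there (here refl)) x≢y = contradiction refl x≢y

  triangle : ∀ {p q} → E p q → (∀ x → ∃₂ λ p q → E p q × x ∉ p ∷ q ∷ []) → Triangle
  triangle {c} {d} cd avoiding = record { cd = cd ; de = de ; ce = ce ; spans = spans }
    where
    third : ∃[ e ] (E d e × c ≢ e)
    third with avoiding c
    ... | p , q , epq , c∉ with other-end (meets-other-end cd epq c∉) epq
    ... | e , e∈ , de = e , de , λ c≡e → c∉ (subst (_∈ p ∷ q ∷ []) (sym c≡e) e∈)

    e : A
    e = proj₁ third
    de : E d e
    de = proj₁ (proj₂ third)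

    ce : E c e
    ce with avoiding d
    ... | _ , _ , ers , d∉ =
      edge-between ers (meets-other-end (E-sym cd) ers d∉) (meets-other-end de ers d∉) (proj₂ (proj₂ third))

    no-common-point : ∀ {h} → h ∈ c ∷ d ∷ [] → h ∈ d ∷ e ∷ [] → h ∈ c ∷ e ∷ [] → ⊥
    no-common-point (here h≡c) (here h≡d) _ = E-irrefl cd (trans (sym h≡c) h≡d)
    no-common-point (here h≡c) (there (here h≡e)) _ = E-irrefl ce (trans (sym h≡c) h≡e)
    no-common-point (there (here h≡d)) _ (here h≡c) = E-irrefl cd (trans (sym h≡c) h≡d)
    no-common-point (there (here h≡d)) _ (there (here h≡e)) = E-irrefl de (trans (sym h≡d) h≡e)

    spans : ∀ {g h} → E g h → g ∈ c ∷ d ∷ e ∷ []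
    spans {g} egh with g ≟ᴬ c | g ≟ᴬ d | g ≟ᴬ e
    ... | yes g≡c | _ | _ = here g≡c
    ... | no _ | yes g≡d | _ = there (here g≡d)
    ... | no _ | no _ | yes g≡e = there (there (here g≡e))
    ... | no g≢c | no g≢d | no g≢e =
      ⊥-elim (no-common-point (meets-other-end egh cd (∉-pair {p = c} g≢c g≢d))
                              (meets-other-end egh de (∉-pair {p = d} g≢d g≢e))
                              (meets-other-end egh ce (∉-pair {p = c} g≢c g≢e)))

module LoneNeighbour {σ : VSet n} (maximal : IsMaximalSimplex σ) {v : Vertex n} {a : Fin n}
  (v∈σ : v ∈ₛ σ) (w∈σ : flipAt a v ∈ₛ σ)
  (only-v : ∀ b → flipAt b (flipAt a v) ∈ₛ σ → flipAt b (flipAt a v) ≡ v)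
  where

  close : ∀ {y z} → y ∈ₛ σ → z ∈ₛ σ → dist y z ≤ 3
  close {y} {z} = proj₂ (proj₁ maximal) y z

  members-meet : ∀ {y z} → y ∈ₛ σ → z ∈ₛ σ → 4 ≤ dist y v + dist z v → ∃[ t ] (y ≢[ t ] v × z ≢[ t ] v)
  members-meet {y} {z} y∈ z∈ heavy = common-differing y z v (≤-trans (s≤s (close y∈ z∈)) heavy)

  Edge : Fin n → Fin n → Set
  Edge p q = p ≢ q × flipAt p (flipAt q v) ∈ₛ σ

  edge-sym : ∀ {p q} → Edge p q → Edge q p
  edge-sym {p} {q} (p≢q , pq∈) = p≢q ∘ sym , subst (_∈ₛ σ) (updateAt-commutes p q p≢q v) pq∈

  edge-meet : ∀ {p q r s} → Edge p q → Edge r s → ∃[ t ] (t ∈ p ∷ q ∷ [] × t ∈ r ∷ s ∷ [])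
  edge-meet {p} {q} {r} {s} (p≢q , pq∈) (r≢s , rs∈)
    with members-meet pq∈ rs∈ (≤-reflexive (sym (cong₂ _+_ (dist-flipAt² v p≢q) (dist-flipAt² v r≢s))))
  ... | t , pq≢v , rs≢v = t , ≢[]-flipAt² p q v pq≢v , ≢[]-flipAt² r s v rs≢v

  neighbour-of-w-∉ : ∀ {b} → b ≢ a → ¬ flipAt b (flipAt a v) ∈ₛ σ
  neighbour-of-w-∉ {b} b≢a ba∈ = flipAt²-≢[] v b≢a (here refl) (cong (λ y → lookupᵛ y b) (only-v b ba∈))

  a∉edge : ∀ {p q} → Edge p q → a ∉ p ∷ q ∷ []
  a∉edge (p≢q , pq∈) (there (here refl)) = neighbour-of-w-∉ p≢q pq∈
  a∉edge pq (here refl) = a∉edge (edge-sym pq) (there (here refl))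

  -- y and u both differ from v at t, so the triangle inequality through v gains 2.
  close-via-shared : ∀ {y u t} → y ∈ₛ σ → dist u v ≡ 2 → y ≢[ t ] v → u ≢[ t ] v → dist y u ≤ 3
  close-via-shared {y} {u} y∈ u₂ y≢v u≢v = s≤s⁻¹ (s≤s⁻¹ (begin
    2 + dist y u        ≤⟨ dist-common y u v y≢v u≢v ⟩
    dist y v + dist u v ≤⟨ +-monoˡ-≤ (dist u v) (close y∈ v∈σ) ⟩
    3 + dist u v        ≡⟨ cong (3 +_) u₂ ⟩
    5                   ∎))
    where open ≤-Reasoning

  edge-avoiding : ∀ {x} → x ≢ a → ∃₂ λ p q → Edge p q × x ∉ p ∷ q ∷ []
  edge-avoiding {x} x≢a with maximal-∌⇒far maximal (flipAt x (flipAt a v)) (neighbour-of-w-∉ x≢a)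
  ... | y , y∈ , far = from-view (within3 y v (close y∈ v∈σ)) y∈ far
    where
    u : Vertex n
    u = flipAt x (flipAt a v)

    u₂ : dist u v ≡ 2
    u₂ = dist-flipAt² v x≢a

    near : ∀ y → dist y v ≤ 1 → dist y u ≤ 3
    near y y≤1 = begin
      dist y u            ≤⟨ dist-via y u v ⟩
      dist y v + dist u v ≤⟨ +-monoˡ-≤ (dist u v) y≤1 ⟩
      1 + dist u v        ≡⟨ cong (1 +_) u₂ ⟩
      3                   ∎
      where open ≤-Reasoning

    from-view : ∀ {y} → Within3 v y → y ∈ₛ σ → 3 < dist y u → ∃₂ λ p q → Edge p q × x ∉ p ∷ q ∷ []
    from-view centre _ far = contradiction (near v (≤-trans (≤-reflexive (dist-self v)) z≤n)) (<⇒≱ far)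
    from-view (one i) _ far = contradiction (near (flipAt i v) (≤-reflexive (dist-flipAt i v))) (<⇒≱ far)
    from-view (two {p} {q} p≢q) y∈ far =
      p , q , (p≢q , y∈) , λ x∈ → <⇒≱ far (close-via-shared y∈ u₂ (flipAt²-≢[] v p≢q x∈) (flipAt²-≢[] v x≢a (here refl)))
    from-view (three y₃) y∈ far with members-meet y∈ w∈σ (≤-reflexive (sym (cong₂ _+_ y₃ (dist-flipAt a v))))
    ... | t , y≢v , w≢v with ≢[]-flipAt a v w≢v
    ... | refl = contradiction (close-via-shared y∈ u₂ y≢v (flipAt²-≢[] v x≢a (there (here refl)))) (<⇒≱ far)

  every-vertex-avoided : 2 ≤ n → ∀ x → ∃₂ λ p q → Edge p q × x ∉ p ∷ q ∷ []
  every-vertex-avoided 2≤n x with x ≟ a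
  ... | no x≢a = edge-avoiding x≢a
  ... | yes refl with ∃-∉ (a ∷ []) 2≤n
  ...   | b , b∉ with edge-avoiding (b∉ ∘ here)
  ...     | p , q , pq , _ = p , q , pq , a∉edge pq

  open IntersectingEdges _≟_ Edge edge-sym proj₁ edge-meet public

  edge-triangle : 2 ≤ n → Triangle
  edge-triangle 2≤n with every-vertex-avoided 2≤n a
  ... | _ , _ , pq , _ = triangle pq (every-vertex-avoided 2≤n)

  module Classification (5≤n : 5 ≤ n) (covers : CoversAllPlaces σ) (T : Triangle) where

    open Triangle T

    a∉corners : a ∉ c ∷ d ∷ e ∷ []
    a∉corners (here a≡c) = a∉edge cd (here a≡c)
    a∉corners (there (here a≡d)) = a∉edge cd (there (here a≡d))
    a∉corners (there (there (here a≡e))) = a∉edge de (there (here a≡e))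

    corners : ∀ {p q t} → Edge p q → t ∈ p ∷ q ∷ [] → t ∈ c ∷ d ∷ e ∷ []
    corners pq (here refl) = spans pq
    corners pq (there (here refl)) = spans (edge-sym pq)

    meets-edge : ∀ {y p q} → y ∈ₛ σ → dist y v ≡ 3 → Edge p q → ∃[ t ] (t ∈ p ∷ q ∷ [] × y ≢[ t ] v)
    meets-edge {y} {p} {q} y∈ y₃ (p≢q , pq∈)
      with members-meet y∈ pq∈ (≤-trans (n≤1+n 4) (≤-reflexive (sym (cong₂ _+_ y₃ (dist-flipAt² v p≢q)))))
    ... | t , y≢v , pq≢v = t , ≢[]-flipAt² p q v pq≢v , y≢v

    four-differences : ∀ {f g h} (y : Vertex n) → dist y v ≡ 3 → f ∉ a ∷ c ∷ d ∷ e ∷ [] → g ≢ h →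
      g ∈ c ∷ d ∷ e ∷ [] → h ∈ c ∷ d ∷ e ∷ [] → All (y ≢[_] v) (f ∷ a ∷ g ∷ h ∷ []) → ⊥
    four-differences {f} {g} {h} y y₃ f∉ g≢h g∈ h∈ differences =
      contradiction (≤-trans (length≤dist (f ∷ a ∷ g ∷ h ∷ []) y v distinct differences) (≤-reflexive y₃))
        λ { (s≤s (s≤s (s≤s ()))) }
      where
      distinct : Unique (f ∷ a ∷ g ∷ h ∷ [])
      distinct = (∉⇒≢ f∉ (here refl) ∷ ∉⇒≢ f∉ (there g∈) ∷ ∉⇒≢ f∉ (there h∈) ∷ [])
               ∷ (∉⇒≢ a∉corners g∈ ∷ ∉⇒≢ a∉corners h∈ ∷ [])
               ∷ (g≢h ∷ []) ∷ [] ∷ []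

    -- A member at distance 3 differs from v at a (it meets w) and at two corners (it meets every edge).
    weight3-agrees-outside : ∀ {f y} → f ∉ a ∷ c ∷ d ∷ e ∷ [] → y ∈ₛ σ → dist y v ≡ 3 → ¬ y ≢[ f ] v
    weight3-agrees-outside {f} {y} f∉ y∈ y₃ y≢ᶠv
      with members-meet y∈ w∈σ (≤-reflexive (sym (cong₂ _+_ y₃ (dist-flipAt a v))))
    ... | t , y≢ᵃv , w≢v with ≢[]-flipAt a v w≢v
    ... | refl with lookupᵛ y c ≟ᵇ lookupᵛ v c
    ...   | yes yᶜ≡vᶜ =
      four-differences y y₃ f∉ (proj₁ de) (there (here refl)) (there (there (here refl)))
        (y≢ᶠv ∷ y≢ᵃv ∷ other-corner y v yᶜ≡vᶜ (meets-edge y∈ y₃ cd) ∷ other-corner y v yᶜ≡vᶜ (meets-edge y∈ y₃ ce) ∷ [])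
    ...   | no y≢ᶜv with meets-edge y∈ y₃ de
    ...     | h , h∈ , y≢ʰv =
      four-differences y y₃ f∉ (∉⇒≢ (∉-pair (proj₁ cd) (proj₁ ce)) h∈) (here refl) (there h∈)
        (y≢ᶠv ∷ y≢ᵃv ∷ y≢ᶜv ∷ y≢ʰv ∷ [])

    no-weight3 : ∀ {y} → y ∈ₛ σ → dist y v ≢ 3
    no-weight3 {y} y∈ y₃ with ∃-∉ (a ∷ c ∷ d ∷ e ∷ []) 5≤n
    ... | f , f∉ with differing-member covers f v
    ... | z , z∈ , z≢ᶠv = from-view (within3 z v (close z∈ v∈σ)) z∈ z≢ᶠv
      where
      from-view : ∀ {z} → Within3 v z → z ∈ₛ σ → ¬ z ≢[ f ] v
      from-view centre _ v≢v = v≢v refl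
      from-view (one i) z∈ z≢ᶠv
        with members-meet z∈ y∈ (≤-reflexive (sym (cong₂ _+_ (dist-flipAt i v) y₃)))
      ... | t , z≢ᵗv , y≢ᵗv with ≢[]-flipAt i v z≢ᶠv | ≢[]-flipAt i v z≢ᵗv
      ... | refl | refl = weight3-agrees-outside f∉ y∈ y₃ y≢ᵗv
      from-view (two {p} {q} p≢q) z∈ z≢ᶠv = f∉ (there (corners (p≢q , z∈) (≢[]-flipAt² p q v z≢ᶠv)))
      from-view (three z₃) z∈ z≢ᶠv = weight3-agrees-outside f∉ z∈ z₃ z≢ᶠv

    edge-in-K : ∀ {p q} → Edge p q → InK v c d e (flipAt p (flipAt q v))
    edge-in-K {p} {q} pq with corners pq (here refl) | corners pq (there (here refl))
    ... | here refl | here refl = contradiction refl (proj₁ pq)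
    ... | here refl | there (here refl) = inj₂ (inj₁ refl)
    ... | here refl | there (there (here refl)) = inj₂ (inj₂ (inj₂ refl))
    ... | there (here refl) | here refl = inj₂ (inj₁ (updateAt-commutes p q (proj₁ pq) v))
    ... | there (here refl) | there (here refl) = contradiction refl (proj₁ pq)
    ... | there (here refl) | there (there (here refl)) = inj₂ (inj₂ (inj₁ refl))
    ... | there (there (here refl)) | here refl = inj₂ (inj₂ (inj₂ (updateAt-commutes p q (proj₁ pq) v)))
    ... | there (there (here refl)) | there (here refl) = inj₂ (inj₂ (inj₁ (updateAt-commutes p q (proj₁ pq) v)))
    ... | there (there (here refl)) | there (there (here refl)) = contradiction refl (proj₁ pq)

    member⇒N∪K : ∀ {y} → y ∈ₛ σ → InN v y ⊎ InK v c d e y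
    member⇒N∪K {y} y∈ = from-view (within3 y v (close y∈ v∈σ)) y∈
      where
      from-view : ∀ {y} → Within3 v y → y ∈ₛ σ → InN v y ⊎ InK v c d e y
      from-view centre _ = inj₂ (inj₁ refl)
      from-view (one i) _ = inj₁ (i , refl)
      from-view (two p≢q) y∈ = inj₂ (edge-in-K (p≢q , y∈))
      from-view (three y₃) y∈ = contradiction y₃ (no-weight3 y∈)

    N∪K⇒member : ∀ {x} → InN v x ⊎ InK v c d e x → x ∈ₛ σ
    N∪K⇒member (inj₁ (i , refl)) = maximal-∋ maximal (flipAt i v) λ y y∈ → begin
      dist y (flipAt i v)                ≤⟨ dist-via y (flipAt i v) v ⟩
      dist y v + dist (flipAt i v) v     ≤⟨ +-monoˡ-≤ _ (s≤s⁻¹ (≤∧≢⇒< (close y∈ v∈σ) (no-weight3 y∈))) ⟩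
      2 + dist (flipAt i v) v            ≡⟨ cong (2 +_) (dist-flipAt i v) ⟩
      3                                  ∎
      where open ≤-Reasoning
    N∪K⇒member (inj₂ (inj₁ refl)) = v∈σ
    N∪K⇒member (inj₂ (inj₂ (inj₁ refl))) = proj₂ cd
    N∪K⇒member (inj₂ (inj₂ (inj₂ (inj₁ refl)))) = proj₂ de
    N∪K⇒member (inj₂ (inj₂ (inj₂ (inj₂ refl)))) = proj₂ ce

lemma4p3 : (n : ℕ) → 5 ≤ n → (σ : VSet n) →
    IsMaximalSimplex σ → CoversAllPlaces σ →
    (w v : Vertex n) → w ∈ₛ σ →
    (∀ x → (InN w x × x ∈ₛ σ) ⇔ (x ≡ v)) →
    ∃[ i₀ ] ∃[ j₀ ] ∃[ k₀ ] (Distinct3 i₀ j₀ k₀ ×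
      (∀ x → x ∈ₛ σ ⇔ (InN v x ⊎ InK v i₀ j₀ k₀ x)))
lemma4p3 n 5≤n σ maximal covers w v w∈σ N[w]∩σ≡v with Equivalence.from (N[w]∩σ≡v v) refl
... | (a , v≡aw) , v∈σ = c , d , e , (proj₁ cd , proj₁ de , proj₁ ce) , λ _ → mk⇔ member⇒N∪K N∪K⇒member
  where
  w≡av : w ≡ flipAt a v
  w≡av = flipAt-inverse a (sym v≡aw)

  only-v : ∀ b → flipAt b (flipAt a v) ∈ₛ σ → flipAt b (flipAt a v) ≡ v
  only-v b ba∈ = Equivalence.to (N[w]∩σ≡v _) ((b , cong (flipAt b) (sym w≡av)) , ba∈)

  open LoneNeighbour maximal v∈σ (subst (_∈ₛ σ) w≡av w∈σ) only-v
  T : Triangle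
  T = edge-triangle (≤-trans (s≤s (s≤s z≤n)) 5≤n)
  open Triangle T
  open Classification 5≤n covers T
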